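{- Let $G=(\mathcal{A}\cup\mathcal{B},E)$ be a finite bipartite graph with strict preference orders, and let $M_1,M_2$ be two stable matchings in $G$ such that $\chi(M_1)$ and $\chi(M_2)$ are the endpoints of an edge of the stable matching polytope $P(G)$. Then there is a single choice of $\{i,j\}=\{1,2\}$ such that for every connected component $J$ of $M_1\triangle M_2$ we have $M_i(a)>_a M_j(a)$ and $M_j(b)>_b M_i(b)$ for all $a\in V(J)\cap\mathcal{A}$ and all $b\in V(J)\cap\mathcal{B}$.
   Context: Each node $u$ has a strict total order $>_u$ on $N(u)\cup\{\varnothing\}$, where $N(u)$ is its neighbour set and $\varnothing$ is least preferred. For a matching $M$, $M(u)$ is the node matched to $u$, or $\varnothing$ if $u$ is unmatched. $M$ is stable if for every edge $uv\notin M$, $M(u)>_u v$ or $M(v)>_v u$. $P(G)=\operatorname{conv}\{\chi(M): M\text{ stable matching in }G\}\subseteq\mathbb{R}^E$, where $\chi(M)$ is the incidence vector of $M$. $M_1\triangle M_2=(M_1\setminus M_2)\cup(M_2\setminus M_1)$, and its connected components are the nontrivial connected components of the graph $(\mathcal{A}\cup\mathcal{B}, M_1\triangle M_2)$.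
   Formalization: The polytope P(G) is taken over the rationals rather than ℝ^E: its points have rational coordinates, and the edge through χ(M₁), χ(M₂) is cut out by an inequality with rational coefficients. -}

module Defs where

open import Data.Nat using (ℕ; zero; suc)
open import Data.Fin using (Fin; zero; suc)
import Data.Fin.Properties as FinP
open import Data.Maybe using (Maybe; just; nothing)
import Data.Maybe.Properties as MaybeP
open import Data.Bool using (Bool; true; false; if_then_else_)
open import Data.Sum using (_⊎_; inj₁; inj₂)
open import Data.Product using (Σ; ∃; _×_; _,_)
open import Data.Empty using (⊥)
open import Data.Unit using (⊤)
open import Relation.Nullary using (¬_; does)
open import Relation.Binary.PropositionalEquality using (_≡_; _≢_)
open import Relation.Binary.Construct.Closure.ReflexiveTransitive using (Star)
open import Data.Rational using (ℚ; 0ℚ; 1ℚ; _+_; _*_; _-_; _≤_)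

-- Preferences: a strict total order on N(u) ∪ {∅} (∅ = nothing),
-- with ∅ least preferred.  N(u) is given by a Boolean indicator.

InNbhd : {n : ℕ} → (Fin n → Bool) → Maybe (Fin n) → Set
InNbhd N nothing  = ⊤
InNbhd N (just b) = N b ≡ true

record IsPref {n : ℕ} (N : Fin n → Bool)
              (_>_ : Maybe (Fin n) → Maybe (Fin n) → Set) : Set where
  field
    irrefl      : ∀ x → InNbhd N x → ¬ (x > x)
    trans       : ∀ x y z → InNbhd N x → InNbhd N y → InNbhd N z →
                  x > y → y > z → x > z
    connected   : ∀ x y → InNbhd N x → InNbhd N y → x ≢ y → (x > y) ⊎ (y > x)
    empty-least : ∀ b → N b ≡ true → just b > nothing

record Instance (m n : ℕ) : Set₁ where
  field
    adj    : Fin m → Fin n → Bool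
    prefA  : Fin m → Maybe (Fin n) → Maybe (Fin n) → Set
    prefB  : Fin n → Maybe (Fin m) → Maybe (Fin m) → Set
    prefA-ok : ∀ a → IsPref (adj a) (prefA a)
    prefB-ok : ∀ b → IsPref (λ a → adj a b) (prefB b)

module _ {m n : ℕ} (G : Instance m n) where
  open Instance G

  record Matching : Set where
    field
      pA : Fin m → Maybe (Fin n)
      pB : Fin n → Maybe (Fin m)
      pA→pB : ∀ a b → pA a ≡ just b → pB b ≡ just a
      pB→pA : ∀ a b → pB b ≡ just a → pA a ≡ just b
      inE   : ∀ a b → pA a ≡ just b → adj a b ≡ true
  open Matching public

  _∋ₘ_,_ : Matching → Fin m → Fin n → Set
  M ∋ₘ a , b = pA M a ≡ just b

  Stable : Matching → Set
  Stable M = ∀ a b → adj a b ≡ true → ¬ (M ∋ₘ a , b) →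
             prefA a (pA M a) (just b) ⊎ prefB b (pB M b) (just a)

  -- vectors in ℚ^(A×B); coordinates outside E play no role
  QVec : Set
  QVec = Fin m → Fin n → ℚ

  χ : Matching → QVec
  χ M a b = if does (MaybeP.≡-dec FinP._≟_ (pA M a) (just b)) then 1ℚ else 0ℚ

sumFin : {k : ℕ} → (Fin k → ℚ) → ℚ
sumFin {zero}  f = 0ℚ
sumFin {suc k} f = f zero + sumFin (λ i → f (suc i))

module _ {m n : ℕ} (G : Instance m n) where
  open Instance G

  dot : QVec G → QVec G → ℚ
  dot c x = sumFin (λ a → sumFin (λ b → c a b * x a b))

  -- (rational points of) the stable matching polytope P(G):
  -- convex combinations of incidence vectors of stable matchings
  InP : QVec G → Set
  InP x = Σ ℕ λ k → Σ (Fin k → ℚ) λ w → Σ (Fin k → Matching G) λ Ms →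
            (∀ i → Stable G (Ms i)) ×
            (∀ i → 0ℚ ≤ w i) ×
            (sumFin w ≡ 1ℚ) ×
            (∀ a b → x a b ≡ sumFin (λ i → w i * χ G (Ms i) a b))

  Segment : QVec G → QVec G → QVec G → Set
  Segment x y z = Σ ℚ λ t → (0ℚ ≤ t) × (t ≤ 1ℚ) ×
                    (∀ a b → z a b ≡ t * x a b + (1ℚ - t) * y a b)

  IsEdge : QVec G → QVec G → Set
  IsEdge x y =
    ¬ (∀ a b → x a b ≡ y a b) ×
    Σ (QVec G) λ c → Σ ℚ λ δ →
      (∀ z → InP z → dot c z ≤ δ) ×
      (∀ z → InP z → dot c z ≡ δ → Segment x y z) ×
      (∀ z → Segment x y z → InP z × dot c z ≡ δ)

  Vertex : Set
  Vertex = Fin m ⊎ Fin n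

  SymDiff : Matching G → Matching G → Fin m → Fin n → Set
  SymDiff M₁ M₂ a b =
    ((_∋ₘ_,_ G M₁ a b) × ¬ (_∋ₘ_,_ G M₂ a b)) ⊎
    ((_∋ₘ_,_ G M₂ a b) × ¬ (_∋ₘ_,_ G M₁ a b))

  Step : Matching G → Matching G → Vertex → Vertex → Set
  Step M₁ M₂ (inj₁ a) (inj₂ b) = SymDiff M₁ M₂ a b
  Step M₁ M₂ (inj₂ b) (inj₁ a) = SymDiff M₁ M₂ a b
  Step M₁ M₂ (inj₁ _) (inj₁ _) = ⊥
  Step M₁ M₂ (inj₂ _) (inj₂ _) = ⊥

  Reach : Matching G → Matching G → Vertex → Vertex → Set
  Reach M₁ M₂ = Star (Step M₁ M₂)

  NonTrivial : Matching G → Matching G → Vertex → Set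
  NonTrivial M₁ M₂ v = ∃ λ w → Step M₁ M₂ v w

  -- Oriented Mᵢ Mⱼ: for every (nontrivial) connected component J of
  -- Mᵢ △ Mⱼ (the component of a vertex v of positive degree),
  -- Mᵢ(a) >_a Mⱼ(a) for all a ∈ V(J) ∩ A and Mⱼ(b) >_b Mᵢ(b) for all b ∈ V(J) ∩ B.
  Oriented : Matching G → Matching G → Set
  Oriented Mᵢ Mⱼ = ∀ v → NonTrivial Mᵢ Mⱼ v →
    (∀ a → Reach Mᵢ Mⱼ v (inj₁ a) → prefA a (pA Mᵢ a) (pA Mⱼ a)) ×
    (∀ b → Reach Mᵢ Mⱼ v (inj₂ b) → prefB b (pB Mⱼ b) (pB Mᵢ b))

-- Stability of M and M′ makes the orientation "a prefers M to M′, b prefers M′ to M" propagate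
-- along every edge of M △ M′: along an edge of M directly from the stability of M′, and along
-- an edge of M′ because a ↦ M′(M(a)) is a permutation of the oriented vertices of A.  So the
-- vertices oriented towards M₁ and those oriented towards M₂ are unions of components, and
-- giving every a the better (resp. worse) of M₁(a), M₂(a) yields stable matchings join and meet
-- with χ(join) + χ(meet) = χ(M₁) + χ(M₂).  If [χ(M₁), χ(M₂)] is an edge of P(G), this forces
-- χ(join) onto the edge, so χ(join) = t χ(M₁) + (1 − t) χ(M₂); a vertex of A oriented towards M₁ gives t = 1 and
-- one oriented towards M₂ gives t = 0, so all vertices are oriented the same way.
module Submission where

open import Defs
open import Data.Bool using (Bool; true; if_then_else_)
open import Data.Empty using (⊥-elim)
open import Data.Fin using (Fin; toℕ)
import Data.Fin.Properties as Fin
open import Data.Maybe using (Maybe; just; nothing; fromMaybe; _>>=_)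
import Data.Maybe.Properties as Maybe
open import Data.Nat using (ℕ; zero; suc)
import Data.Nat as ℕ
open import Data.Nat.GeneralisedArithmetic using (fold; fold-+)
import Data.Nat.Properties as ℕₚ
open import Data.Product using (∃; _×_; _,_; proj₁; proj₂)
import Data.Product as Product
open import Data.Rational using (ℚ; 0ℚ; 1ℚ; _+_; _*_; _-_; _≤_)
import Data.Rational.Properties as ℚ
open import Data.Rational.Solver using (module +-*-Solver)
open import Data.Sum using (_⊎_; inj₁; inj₂; [_,_])
import Data.Sum as Sum
open import Data.Unit using (tt)
open import Function using (_∘_)
open import Function.Bundles using (_⇔_; mk⇔; Equivalence)
open import Relation.Binary.Construct.Closure.ReflexiveTransitive using (ε; _◅_)
open import Relation.Binary.PropositionalEquality
  using (_≡_; _≢_; refl; sym; trans; cong; cong₂; subst; module ≡-Reasoning)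
open import Relation.Nullary using (¬_; Dec; yes; no; does; contradiction)
open import Relation.Nullary.Decidable using (dec-true; dec-false)
open import Relation.Unary using (Pred; Decidable)

open +-*-Solver

module Preference {k : ℕ} {N : Fin k → Bool} {_>_ : Maybe (Fin k) → Maybe (Fin k) → Set}
                  (isPref : IsPref N _>_) where
  open IsPref isPref public renaming (trans to >-trans)

  >-asym : ∀ {x y} → InNbhd N x → InNbhd N y → x > y → ¬ (y > x)
  >-asym {x} {y} x∈N y∈N x>y y>x = irrefl x x∈N (>-trans x y x x∈N y∈N x∈N x>y y>x)

  nothing-minimal : ∀ {y} → InNbhd N y → ¬ (nothing > y)
  nothing-minimal {nothing} _   = irrefl nothing tt
  nothing-minimal {just b}  b∈N nothing>b = >-asym b∈N tt (empty-least b b∈N) nothing>b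

  _>?_ : ∀ x y → {InNbhd N x} → {InNbhd N y} → Dec (x > y)
  (x >? y) {x∈N} {y∈N} with Maybe.≡-dec Fin._≟_ x y
  ... | yes refl = no (irrefl x x∈N)
  ... | no x≢y   = Sum.[ yes , no ∘ >-asym y∈N x∈N ] (connected x y x∈N y∈N x≢y)

  ≯∧≢⇒< : ∀ {x y} → InNbhd N x → InNbhd N y → ¬ (x > y) → x ≢ y → y > x
  ≯∧≢⇒< {x} {y} x∈N y∈N x≯y x≢y = Sum.[ ⊥-elim ∘ x≯y , (λ y>x → y>x) ] (connected x y x∈N y∈N x≢y)

  max-dominates : ∀ {x y z} → InNbhd N x → InNbhd N y → InNbhd N z → (x>?y : Dec (x > y)) →
                  z > (if does x>?y then x else y) → z > x × z > y
  max-dominates {x} {y} {z} x∈N y∈N z∈N (yes x>y) z>x = z>x , >-trans z x y z∈N x∈N y∈N z>x x>y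
  max-dominates {x} {y} {z} x∈N y∈N z∈N (no x≯y)  z>y with Maybe.≡-dec Fin._≟_ x y
  ... | yes refl = z>y , z>y
  ... | no x≢y   = >-trans z y x z∈N y∈N x∈N z>y (≯∧≢⇒< x∈N y∈N x≯y x≢y) , z>y

module Prefᴬ {m n : ℕ} (G : Instance m n) (a : Fin m) = Preference (Instance.prefA-ok G a)
module Prefᴮ {m n : ℕ} (G : Instance m n) (b : Fin n) = Preference (Instance.prefB-ok G b)

transpose : {m n : ℕ} → Instance m n → Instance n m
transpose G = record
  { adj = λ b a → adj a b ; prefA = prefB ; prefB = prefA ; prefA-ok = prefB-ok ; prefB-ok = prefA-ok }
  where open Instance G

module _ {m n : ℕ} {G : Instance m n} where
  open Instance G

  pA∈N : (M : Matching G) (a : Fin m) → InNbhd (adj a) (pA M a)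
  pA∈N M a with pA M a in eq
  ... | nothing = tt
  ... | just b  = inE M a b eq

  pB∈N : (M : Matching G) (b : Fin n) → InNbhd (λ a → adj a b) (pB M b)
  pB∈N M b with pB M b in eq
  ... | nothing = tt
  ... | just a  = inE M a b (pB→pA M a b eq)

  pA-injective : (M : Matching G) {a a′ : Fin m} {b : Fin n} →
                 pA M a ≡ just b → pA M a′ ≡ just b → a ≡ a′
  pA-injective M {a} {a′} {b} ab∈M a′b∈M =
    Maybe.just-injective (trans (sym (pA→pB M a b ab∈M)) (pA→pB M a′ b a′b∈M))

  transposeᴹ : Matching G → Matching (transpose G)
  transposeᴹ M = record
    { pA = pB M ; pB = pA M
    ; pA→pB = λ b a → pB→pA M a b ; pB→pA = λ b a → pA→pB M a b
    ; inE = λ b a ba∈M → inE M a b (pB→pA M a b ba∈M) }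

  transpose-stable : (M : Matching G) → Stable G M → Stable (transpose G) (transposeᴹ M)
  transpose-stable M stable b a ab∈E ab∉M = Sum.swap (stable a b ab∈E (ab∉M ∘ pA→pB M a b))

module _ {k : ℕ} {p} {P : Pred (Fin k) p} (f : Fin k → Fin k)
         (f-pres : ∀ {x} → P x → P (f x))
         (f-injective : ∀ {x y} → P x → P y → f x ≡ f y → x ≡ y) where

  private
    fold-pres : ∀ {x} i → P x → P (fold x f i)
    fold-pres zero    Px = Px
    fold-pres (suc i) Px = f-pres (fold-pres i Px)

    fold-cancel : ∀ {x y} i → P x → P y → fold x f i ≡ fold y f i → x ≡ y
    fold-cancel zero    Px Py eq = eq
    fold-cancel (suc i) Px Py eq = fold-cancel i Px Py (f-injective (fold-pres i Px) (fold-pres i Py) eq)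

  -- The orbit of x must repeat, and injectivity lets us cancel its first steps.
  injectiveOn⇒surjectiveOn : ∀ {x} → P x → ∃ λ y → P y × f y ≡ x
  injectiveOn⇒surjectiveOn {x} Px
    with i , j , i<j , fᵢ≡fⱼ ← Fin.pigeonhole (ℕₚ.n<1+n k) (λ i → fold x f (toℕ i))
    with d , 1+i+d≡j ← ℕₚ.m≤n⇒∃[o]m+o≡n i<j
    = fold x f d , fold-pres d Px , sym (fold-cancel (toℕ i) Px (fold-pres (suc d) Px) (begin
        fold x f (toℕ i)                ≡⟨ fᵢ≡fⱼ ⟩
        fold x f (toℕ j)                ≡⟨ cong (fold x f) (trans (sym 1+i+d≡j) (sym (ℕₚ.+-suc (toℕ i) d))) ⟩
        fold x f (toℕ i ℕ.+ suc d)      ≡⟨ fold-+ x f (toℕ i) ⟩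
        fold (fold x f (suc d)) f (toℕ i) ∎))
    where open ≡-Reasoning

module _ {m n : ℕ} (G : Instance m n) where
  open Instance G

  OrientedAt : Matching G → Matching G → Vertex G → Set
  OrientedAt Mᵢ Mⱼ (inj₁ a) = prefA a (pA Mᵢ a) (pA Mⱼ a)
  OrientedAt Mᵢ Mⱼ (inj₂ b) = prefB b (pB Mⱼ b) (pB Mᵢ b)

  orientedAt? : (Mᵢ Mⱼ : Matching G) → Decidable (OrientedAt Mᵢ Mⱼ)
  orientedAt? Mᵢ Mⱼ (inj₁ a) = Prefᴬ._>?_ G a (pA Mᵢ a) (pA Mⱼ a) {pA∈N Mᵢ a} {pA∈N Mⱼ a}
  orientedAt? Mᵢ Mⱼ (inj₂ b) = Prefᴮ._>?_ G b (pB Mⱼ b) (pB Mᵢ b) {pB∈N Mⱼ b} {pB∈N Mᵢ b}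

  Blocks : Matching G → Fin m → Fin n → Set
  Blocks M a b = adj a b ≡ true × prefA a (just b) (pA M a) × prefB b (just a) (pB M b)

module _ {m n : ℕ} {G : Instance m n} (M M′ : Matching G) where
  open Instance G

  oriented⇒matched : ∀ {a} → OrientedAt G M M′ (inj₁ a) → ∃ λ b → pA M a ≡ just b
  oriented⇒matched {a} o with pA M a
  ... | nothing = ⊥-elim (Prefᴬ.nothing-minimal G a (pA∈N M′ a) o)
  ... | just b  = b , refl

  oriented⇒∉M′ : ∀ {a b} → OrientedAt G M M′ (inj₁ a) → pA M a ≡ just b → pA M′ a ≢ just b
  oriented⇒∉M′ {a} o ab∈M ab∈M′ =
    Prefᴬ.irrefl G a (pA M a) (pA∈N M a) (subst (prefA a (pA M a)) (trans ab∈M′ (sym ab∈M)) o)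

  oriented⇒¬reversed : ∀ {a} → OrientedAt G M M′ (inj₁ a) → ¬ OrientedAt G M′ M (inj₁ a)
  oriented⇒¬reversed {a} = Prefᴬ.>-asym G a (pA∈N M a) (pA∈N M′ a)

  oriented-A⇒B-along-M : Stable G M′ → ∀ {a b} → pA M a ≡ just b →
                         OrientedAt G M M′ (inj₁ a) → OrientedAt G M M′ (inj₂ b)
  oriented-A⇒B-along-M stable′ {a} {b} ab∈M o
    rewrite ab∈M | pA→pB M a b ab∈M
    with stable′ a b (inE M a b ab∈M)
           (λ ab∈M′ → Prefᴬ.irrefl G a (just b) (inE M a b ab∈M) (subst (prefA a (just b)) ab∈M′ o))
  ... | inj₁ a-prefers-M′ = ⊥-elim (Prefᴬ.>-asym G a (inE M a b ab∈M) (pA∈N M′ a) o a-prefers-M′)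
  ... | inj₂ b-prefers-M′ = b-prefers-M′

-- Transposition swaps A and B, and OrientedAt G M M′ (inj₂ b) is definitionally
-- OrientedAt (transpose G) (transposeᴹ M′) (transposeᴹ M) (inj₁ b).
module _ {m n : ℕ} {G : Instance m n} (M M′ : Matching G) where

  oriented⇒matchedᴮ : ∀ {b} → OrientedAt G M M′ (inj₂ b) → ∃ λ a → pB M′ b ≡ just a
  oriented⇒matchedᴮ = oriented⇒matched (transposeᴹ M′) (transposeᴹ M)

  oriented-B⇒A-along-M′ : Stable G M → ∀ {a b} → pB M′ b ≡ just a →
                          OrientedAt G M M′ (inj₂ b) → OrientedAt G M M′ (inj₁ a)
  oriented-B⇒A-along-M′ stable =
    oriented-A⇒B-along-M (transposeᴹ M′) (transposeᴹ M) (transpose-stable M stable)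

module _ {m n : ℕ} {G : Instance m n} (M M′ : Matching G) (stable : Stable G M) (stable′ : Stable G M′) where
  open Instance G

  private
    Oriented-A : Pred (Fin m) _
    Oriented-A a = OrientedAt G M M′ (inj₁ a)

    -- the default a is junk: next is only used on oriented a, which have M′(M(a)) ≠ ∅
    next : Fin m → Fin m
    next a = fromMaybe a (pA M a >>= pB M′)

    next-≡ : ∀ {a b c} → pA M a ≡ just b → pB M′ b ≡ just c → next a ≡ c
    next-≡ {a} ab∈M bc∈M′ = trans (cong (λ x → fromMaybe a (x >>= pB M′)) ab∈M) (cong (fromMaybe a) bc∈M′)

    oriented-next : ∀ {a} → Oriented-A a →
                    ∃ λ b → pA M a ≡ just b × pB M′ b ≡ just (next a) × Oriented-A (next a)
    oriented-next o
      with b , ab∈M ← oriented⇒matched M M′ o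
      with oᵇ ← oriented-A⇒B-along-M M M′ stable′ ab∈M o
      with c , bc∈M′ ← oriented⇒matchedᴮ M M′ oᵇ
      = b , ab∈M , subst (λ c → pB M′ b ≡ just c × Oriented-A c) (sym (next-≡ ab∈M bc∈M′))
                         (bc∈M′ , oriented-B⇒A-along-M′ M M′ stable bc∈M′ oᵇ)

    next-injective : ∀ {x y} → Oriented-A x → Oriented-A y → next x ≡ next y → x ≡ y
    next-injective {x} {y} oˣ oʸ eq =
      let b  , xb∈M  , bx′∈M′  , _ = oriented-next oˣ
          b′ , yb′∈M , b′y′∈M′ , _ = oriented-next oʸ
          b′≡b = pA-injective (transposeᴹ M′) b′y′∈M′ (trans bx′∈M′ (cong just eq))
      in pA-injective M xb∈M (subst (λ b → pA M y ≡ just b) b′≡b yb′∈M)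

  oriented-A⇒B-along-M′ : ∀ {a b} → pA M′ a ≡ just b →
                          OrientedAt G M M′ (inj₁ a) → OrientedAt G M M′ (inj₂ b)
  -- a = M′(M(a₀)) for an oriented a₀, so b = M(a₀) and we can go along M instead.
  oriented-A⇒B-along-M′ {a} {b} ab∈M′ o
    with a₀ , o₀ , next-a₀≡a ← injectiveOn⇒surjectiveOn next (proj₂ ∘ proj₂ ∘ proj₂ ∘ oriented-next)
                                                          next-injective o
    with b₀ , a₀b₀∈M , b₀a∈M′ , _ ← oriented-next o₀
    with refl ← trans (sym ab∈M′) (pB→pA M′ a b₀ (trans b₀a∈M′ (cong just next-a₀≡a)))
    = oriented-A⇒B-along-M M M′ stable′ a₀b₀∈M o₀

module _ {m n : ℕ} {G : Instance m n} (M M′ : Matching G) (stable : Stable G M) (stable′ : Stable G M′) where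
  open Instance G

  oriented-B⇒A-along-M : ∀ {a b} → pB M b ≡ just a →
                         OrientedAt G M M′ (inj₂ b) → OrientedAt G M M′ (inj₁ a)
  oriented-B⇒A-along-M = oriented-A⇒B-along-M′ (transposeᴹ M′) (transposeᴹ M)
                           (transpose-stable M′ stable′) (transpose-stable M stable)

  oriented-A⇒B : ∀ {a b} → pA M a ≡ just b ⊎ pA M′ a ≡ just b →
                 OrientedAt G M M′ (inj₁ a) → OrientedAt G M M′ (inj₂ b)
  oriented-A⇒B = [ oriented-A⇒B-along-M M M′ stable′ , oriented-A⇒B-along-M′ M M′ stable stable′ ]

  oriented-B⇒A : ∀ {a b} → pA M a ≡ just b ⊎ pA M′ a ≡ just b →
                 OrientedAt G M M′ (inj₂ b) → OrientedAt G M M′ (inj₁ a)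
  oriented-B⇒A {a} {b} =
    [ oriented-B⇒A-along-M ∘ pA→pB M a b , oriented-B⇒A-along-M′ M M′ stable ∘ pA→pB M′ a b ]

  oriented-reach : ∀ {u w} → Reach G M M′ u w → OrientedAt G M M′ u → OrientedAt G M M′ w
  oriented-reach ε = λ o → o
  oriented-reach (_◅_ {inj₁ _} {inj₂ _} step rest) = oriented-reach rest ∘ oriented-A⇒B (Sum.map proj₁ proj₁ step)
  oriented-reach (_◅_ {inj₂ _} {inj₁ _} step rest) = oriented-reach rest ∘ oriented-B⇒A (Sum.map proj₁ proj₁ step)

module _ {m n : ℕ} {G : Instance m n} (M : Matching G) where
  open Instance G

  stable⇒¬blocks : Stable G M → ∀ {a b} → ¬ Blocks G M a b
  stable⇒¬blocks stable {a} {b} (ab∈E , a-prefers-b , b-prefers-a)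
    with stable a b ab∈E
           (λ ab∈M → Prefᴬ.irrefl G a (just b) ab∈E (subst (prefA a (just b)) ab∈M a-prefers-b))
  ... | inj₁ a-prefers-M = Prefᴬ.>-asym G a (pA∈N M a) ab∈E a-prefers-M a-prefers-b
  ... | inj₂ b-prefers-M = Prefᴮ.>-asym G b (pB∈N M b) ab∈E b-prefers-M b-prefers-a

  ¬blocks⇒stable : (∀ a b → ¬ Blocks G M a b) → Stable G M
  ¬blocks⇒stable unblocked a b ab∈E ab∉M
    with Prefᴬ._>?_ G a (pA M a) (just b) {pA∈N M a} {ab∈E}
       | Prefᴮ._>?_ G b (pB M b) (just a) {pB∈N M b} {ab∈E}
  ... | yes a-prefers-M | _               = inj₁ a-prefers-M
  ... | no _            | yes b-prefers-M = inj₂ b-prefers-M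
  ... | no a-prefers-b  | no b-prefers-a  = ⊥-elim (unblocked a b
        ( ab∈E
        , Prefᴬ.≯∧≢⇒< G a (pA∈N M a) ab∈E a-prefers-b ab∉M
        , Prefᴮ.≯∧≢⇒< G b (pB∈N M b) ab∈E b-prefers-a (ab∉M ∘ pB→pA M a b)))

module _ {m n : ℕ} {G : Instance m n} (M₁ M₂ J : Matching G) where
  open Instance G

  -- A pair blocking J blocks the Mᵢ with J(b) = Mᵢ(b).
  upper-boundᴬ⇒stable : Stable G M₁ → Stable G M₂ →
    (∀ {a b} → adj a b ≡ true → prefA a (just b) (pA J a) →
       prefA a (just b) (pA M₁ a) × prefA a (just b) (pA M₂ a)) →
    (∀ b → pB J b ≡ pB M₁ b ⊎ pB J b ≡ pB M₂ b) → Stable G J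
  upper-boundᴬ⇒stable stable₁ stable₂ upper-bound choice = ¬blocks⇒stable J unblocked
    where
    unblocked : ∀ a b → ¬ Blocks G J a b
    unblocked a b (ab∈E , a-prefers-b , b-prefers-a) = Sum.[
        (λ J≡M₁ → stable⇒¬blocks M₁ stable₁ (ab∈E , proj₁ above , subst (prefB b (just a)) J≡M₁ b-prefers-a)) ,
        (λ J≡M₂ → stable⇒¬blocks M₂ stable₂ (ab∈E , proj₂ above , subst (prefB b (just a)) J≡M₂ b-prefers-a)) ]
      (choice b)
      where above = upper-bound ab∈E a-prefers-b

module _ {m n : ℕ} {G : Instance m n} (M₁ M₂ : Matching G) {ℓ} {S : Pred (Vertex G) ℓ} (S? : Decidable S)
         (S-closed : ∀ {a b} → pA M₁ a ≡ just b ⊎ pA M₂ a ≡ just b → S (inj₁ a) ⇔ S (inj₂ b)) where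
  open Instance G
  open Equivalence

  private
    pAˢ : Fin m → Maybe (Fin n)
    pAˢ a = if does (S? (inj₁ a)) then pA M₁ a else pA M₂ a

    pBˢ : Fin n → Maybe (Fin m)
    pBˢ b = if does (S? (inj₂ b)) then pB M₁ b else pB M₂ b

    pAˢ→pBˢ : ∀ a b → pAˢ a ≡ just b → pBˢ b ≡ just a
    pAˢ→pBˢ a b ab∈Mˢ with S? (inj₁ a) | S? (inj₂ b)
    ... | yes _  | yes _  = pA→pB M₁ a b ab∈Mˢ
    ... | yes Sa | no ¬Sb = ⊥-elim (¬Sb (to (S-closed (inj₁ ab∈Mˢ)) Sa))
    ... | no ¬Sa | yes Sb = ⊥-elim (¬Sa (from (S-closed (inj₂ ab∈Mˢ)) Sb))
    ... | no _   | no _   = pA→pB M₂ a b ab∈Mˢ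

    pBˢ→pAˢ : ∀ a b → pBˢ b ≡ just a → pAˢ a ≡ just b
    pBˢ→pAˢ a b ba∈Mˢ with S? (inj₁ a) | S? (inj₂ b)
    ... | yes _  | yes _  = pB→pA M₁ a b ba∈Mˢ
    ... | no ¬Sa | yes Sb = ⊥-elim (¬Sa (from (S-closed (inj₁ (pB→pA M₁ a b ba∈Mˢ))) Sb))
    ... | yes Sa | no ¬Sb = ⊥-elim (¬Sb (to (S-closed (inj₂ (pB→pA M₂ a b ba∈Mˢ))) Sa))
    ... | no _   | no _   = pB→pA M₂ a b ba∈Mˢ

    pAˢ∈E : ∀ a b → pAˢ a ≡ just b → adj a b ≡ true
    pAˢ∈E a b with S? (inj₁ a)
    ... | yes _ = inE M₁ a b
    ... | no _  = inE M₂ a b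

  splice : Matching G
  splice = record { pA = pAˢ ; pB = pBˢ ; pA→pB = pAˢ→pBˢ ; pB→pA = pBˢ→pAˢ ; inE = pAˢ∈E }

  splice-inᴬ : ∀ {a} → S (inj₁ a) → pA splice a ≡ pA M₁ a
  splice-inᴬ {a} Sa with S? (inj₁ a)
  ... | yes _  = refl
  ... | no ¬Sa = contradiction Sa ¬Sa

  splice-outᴬ : ∀ {a} → ¬ S (inj₁ a) → pA splice a ≡ pA M₂ a
  splice-outᴬ {a} ¬Sa with S? (inj₁ a)
  ... | yes Sa = contradiction Sa ¬Sa
  ... | no _   = refl

  splice-choiceᴬ : ∀ a → pA splice a ≡ pA M₁ a ⊎ pA splice a ≡ pA M₂ a
  splice-choiceᴬ a with S? (inj₁ a)
  ... | yes _ = inj₁ refl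
  ... | no _  = inj₂ refl

  splice-choiceᴮ : ∀ b → pB splice b ≡ pB M₁ b ⊎ pB splice b ≡ pB M₂ b
  splice-choiceᴮ b with S? (inj₂ b)
  ... | yes _ = inj₁ refl
  ... | no _  = inj₂ refl

module _ {m n : ℕ} {G : Instance m n} (M₁ M₂ : Matching G) (stable₁ : Stable G M₁) (stable₂ : Stable G M₂) where
  open Instance G

  private
    oriented-closed : ∀ {a b} → pA M₁ a ≡ just b ⊎ pA M₂ a ≡ just b →
                      OrientedAt G M₁ M₂ (inj₁ a) ⇔ OrientedAt G M₁ M₂ (inj₂ b)
    oriented-closed e = mk⇔ (oriented-A⇒B M₁ M₂ stable₁ stable₂ e) (oriented-B⇒A M₁ M₂ stable₁ stable₂ e)

  -- every a takes the better and every b the worse of its two partners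
  join : Matching G
  join = splice M₁ M₂ (orientedAt? G M₁ M₂) oriented-closed

  -- every a takes the worse and every b the better of its two partners
  meet : Matching G
  meet = splice M₂ M₁ (orientedAt? G M₁ M₂) (oriented-closed ∘ Sum.swap)

  join-stable : Stable G join
  join-stable = upper-boundᴬ⇒stable M₁ M₂ join stable₁ stable₂ upper-bound
                  (splice-choiceᴮ M₁ M₂ (orientedAt? G M₁ M₂) oriented-closed)
    where
    upper-bound : ∀ {a b} → adj a b ≡ true → prefA a (just b) (pA join a) →
                  prefA a (just b) (pA M₁ a) × prefA a (just b) (pA M₂ a)
    upper-bound {a} ab∈E =
      Prefᴬ.max-dominates G a (pA∈N M₁ a) (pA∈N M₂ a) ab∈E (orientedAt? G M₁ M₂ (inj₁ a))

  -- The meet is a join of the transposed instance; transposing twice is definitionally the identity.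
  meet-stable : Stable G meet
  meet-stable = transpose-stable (transposeᴹ meet)
    (upper-boundᴬ⇒stable (transposeᴹ M₁) (transposeᴹ M₂) (transposeᴹ meet)
      (transpose-stable M₁ stable₁) (transpose-stable M₂ stable₂) upper-bound
      (Sum.swap ∘ splice-choiceᴬ M₂ M₁ (orientedAt? G M₁ M₂) (oriented-closed ∘ Sum.swap)))
    where
    upper-bound : ∀ {b a} → adj a b ≡ true → prefB b (just a) (pB meet b) →
                  prefB b (just a) (pB M₁ b) × prefB b (just a) (pB M₂ b)
    upper-bound {b} ab∈E =
      Product.swap ∘ Prefᴮ.max-dominates G b (pB∈N M₂ b) (pB∈N M₁ b) ab∈E (orientedAt? G M₁ M₂ (inj₂ b))

  join-oriented : ∀ {a} → OrientedAt G M₁ M₂ (inj₁ a) → pA join a ≡ pA M₁ a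
  join-oriented = splice-inᴬ M₁ M₂ (orientedAt? G M₁ M₂) oriented-closed

  join-reversed : ∀ {a} → OrientedAt G M₂ M₁ (inj₁ a) → pA join a ≡ pA M₂ a
  join-reversed = splice-outᴬ M₁ M₂ (orientedAt? G M₁ M₂) oriented-closed ∘ oriented⇒¬reversed M₂ M₁

  join-meet-complementary : ∀ a → pA join a ≡ pA M₁ a × pA meet a ≡ pA M₂ a
                               ⊎ pA join a ≡ pA M₂ a × pA meet a ≡ pA M₁ a
  join-meet-complementary a with orientedAt? G M₁ M₂ (inj₁ a)
  ... | yes _ = inj₁ (refl , refl)
  ... | no _  = inj₂ (refl , refl)

module _ {m n : ℕ} {G : Instance m n} where
  open Instance G

  χ-cong : ∀ M M′ {a} → pA M a ≡ pA M′ a → ∀ b → χ G M a b ≡ χ G M′ a b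
  χ-cong M M′ eq b = cong (λ x → if does (Maybe.≡-dec Fin._≟_ x (just b)) then 1ℚ else 0ℚ) eq

  χ-matched : ∀ M {a b} → pA M a ≡ just b → χ G M a b ≡ 1ℚ
  χ-matched M {a} {b} ab∈M =
    cong (if_then 1ℚ else 0ℚ) (dec-true (Maybe.≡-dec Fin._≟_ (pA M a) (just b)) ab∈M)

  χ-unmatched : ∀ M {a b} → pA M a ≢ just b → χ G M a b ≡ 0ℚ
  χ-unmatched M {a} {b} ab∉M =
    cong (if_then 1ℚ else 0ℚ) (dec-false (Maybe.≡-dec Fin._≟_ (pA M a) (just b)) ab∉M)

  χ-complementary : ∀ M₁ M₂ J K →
    (∀ a → pA J a ≡ pA M₁ a × pA K a ≡ pA M₂ a ⊎ pA J a ≡ pA M₂ a × pA K a ≡ pA M₁ a) →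
    ∀ a b → χ G J a b + χ G K a b ≡ χ G M₁ a b + χ G M₂ a b
  χ-complementary M₁ M₂ J K complementary a b with complementary a
  ... | inj₁ (J≡M₁ , K≡M₂) = cong₂ _+_ (χ-cong J M₁ J≡M₁ b) (χ-cong K M₂ K≡M₂ b)
  ... | inj₂ (J≡M₂ , K≡M₁) =
    trans (cong₂ _+_ (χ-cong J M₂ J≡M₂ b) (χ-cong K M₁ K≡M₁ b)) (ℚ.+-comm (χ G M₂ a b) (χ G M₁ a b))

  χ∈P : ∀ M → Stable G M → InP G (χ G M)
  χ∈P M stable = 1 , (λ _ → 1ℚ) , (λ _ → M) , (λ _ → stable) , (λ _ → ℚ.nonNegative⁻¹ 1ℚ) , refl ,
                 λ a b → solve 1 (λ x → x := con 1ℚ :* x :+ con 0ℚ) refl (χ G M a b)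

sumFin-cong : ∀ {k} {f g : Fin k → ℚ} → (∀ i → f i ≡ g i) → sumFin f ≡ sumFin g
sumFin-cong {zero}  eq = refl
sumFin-cong {suc k} eq = cong₂ _+_ (eq Fin.zero) (sumFin-cong (eq ∘ Fin.suc))

sumFin-+ : ∀ {k} (f g : Fin k → ℚ) → sumFin f + sumFin g ≡ sumFin (λ i → f i + g i)
sumFin-+ {zero}  f g = refl
sumFin-+ {suc k} f g =
  trans (interchange (f Fin.zero) (sumFin (f ∘ Fin.suc)) (g Fin.zero) (sumFin (g ∘ Fin.suc)))
        (cong (f Fin.zero + g Fin.zero +_) (sumFin-+ (f ∘ Fin.suc) (g ∘ Fin.suc)))
  where
  interchange : ∀ w x y z → (w + x) + (y + z) ≡ (w + y) + (x + z)
  interchange = solve 4 (λ w x y z → (w :+ x) :+ (y :+ z) := (w :+ y) :+ (x :+ z)) refl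

module _ {m n : ℕ} {G : Instance m n} where

  dot-+ : ∀ c (x y : QVec G) → dot G c x + dot G c y ≡ dot G c (λ a b → x a b + y a b)
  dot-+ c x y = trans (sumFin-+ (λ a → sumFin (λ b → c a b * x a b)) (λ a → sumFin (λ b → c a b * y a b)))
                      (sumFin-cong λ a → trans (sumFin-+ (λ b → c a b * x a b) (λ b → c a b * y a b))
                                               (sumFin-cong λ b → sym (ℚ.*-distribˡ-+ (c a b) (x a b) (y a b))))

  dot-cong : ∀ c {x y : QVec G} → (∀ a b → x a b ≡ y a b) → dot G c x ≡ dot G c y
  dot-cong c eq = sumFin-cong λ a → sumFin-cong λ b → cong (c a b *_) (eq a b)

  segment-left : ∀ {x y : QVec G} → Segment G x y x
  segment-left {x} {y} = 1ℚ , ℚ.nonNegative⁻¹ 1ℚ , ℚ.≤-refl ,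
    λ a b → solve 2 (λ x y → x := con 1ℚ :* x :+ (con 1ℚ :- con 1ℚ) :* y) refl (x a b) (y a b)

  segment-right : ∀ {x y : QVec G} → Segment G x y y
  segment-right {x} {y} = 0ℚ , ℚ.≤-refl , ℚ.nonNegative⁻¹ 1ℚ ,
    λ a b → solve 2 (λ x y → y := con 0ℚ :* x :+ (con 1ℚ :- con 0ℚ) :* y) refl (x a b) (y a b)

  segment-complementary : ∀ (x y z : QVec G) → Segment G x y z → ∀ {a b a′ b′} →
    x a b ≡ 1ℚ → y a b ≡ 0ℚ → x a′ b′ ≡ 0ℚ → y a′ b′ ≡ 1ℚ → z a b + z a′ b′ ≡ 1ℚ
  segment-complementary x y z (t , _ , _ , z≡) {a} {b} {a′} {b′} x₁ y₀ x₀′ y₁′ = begin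
    z a b + z a′ b′
      ≡⟨ cong₂ _+_ (z≡ a b) (z≡ a′ b′) ⟩
    combination (x a b) (y a b) + combination (x a′ b′) (y a′ b′)
      ≡⟨ cong₂ _+_ (cong₂ combination x₁ y₀) (cong₂ combination x₀′ y₁′) ⟩
    combination 1ℚ 0ℚ + combination 0ℚ 1ℚ
      ≡⟨ weights-sum t ⟩
    1ℚ ∎
    where
    open ≡-Reasoning
    combination : ℚ → ℚ → ℚ
    combination p q = t * p + (1ℚ - t) * q
    weights-sum : ∀ t → (t * 1ℚ + (1ℚ - t) * 0ℚ) + (t * 0ℚ + (1ℚ - t) * 1ℚ) ≡ 1ℚ
    weights-sum = solve 1 (λ t → (t :* con 1ℚ :+ (con 1ℚ :- t) :* con 0ℚ)
                              :+ (t :* con 0ℚ :+ (con 1ℚ :- t) :* con 1ℚ) := con 1ℚ) refl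

  -- If u + v = x + y with u, v ∈ P, both c·u ≤ δ and c·v ≤ δ sum to 2δ, so u lies on the face.
  edge-decomposition⇒segment : ∀ {x y u v : QVec G} → IsEdge G x y → InP G u → InP G v →
    (∀ a b → u a b + v a b ≡ x a b + y a b) → Segment G x y u
  edge-decomposition⇒segment {x} {y} {u} {v} (_ , c , δ , valid , face⇒segment , segment⇒face) u∈P v∈P u+v≡x+y =
    face⇒segment u u∈P (≤∧≤∧+≡⇒≡ (valid u u∈P) (valid v v∈P) (begin
      dot G c u + dot G c v             ≡⟨ dot-+ c u v ⟩
      dot G c (λ a b → u a b + v a b)   ≡⟨ dot-cong c u+v≡x+y ⟩
      dot G c (λ a b → x a b + y a b)   ≡⟨ sym (dot-+ c x y) ⟩
      dot G c x + dot G c y             ≡⟨ cong₂ _+_ (proj₂ (segment⇒face x segment-left))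
                                                     (proj₂ (segment⇒face y segment-right)) ⟩
      δ + δ                             ∎))
    where
    open ≡-Reasoning
    ≤∧≤∧+≡⇒≡ : ∀ {p q d} → p ≤ d → q ≤ d → p + q ≡ d + d → p ≡ d
    ≤∧≤∧+≡⇒≡ {p} {q} {d} p≤d q≤d p+q≡d+d with d ℚ.≤? p
    ... | yes d≤p = ℚ.≤-antisym p≤d d≤p
    ... | no d≰p  = contradiction p+q≡d+d (ℚ.<⇒≢ (ℚ.+-mono-<-≤ (ℚ.≰⇒> d≰p) q≤d))

module _ {m n : ℕ} {G : Instance m n} (M₁ M₂ : Matching G) (stable₁ : Stable G M₁) (stable₂ : Stable G M₂) where
  open Instance G

  -- χ(join) would lie on the edge, with weight 1 on χ(M₁) at a and weight 1 on χ(M₂) at a′.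
  edge⇒¬mixed : IsEdge G (χ G M₁) (χ G M₂) → ∀ {a a′} →
                OrientedAt G M₁ M₂ (inj₁ a) → ¬ OrientedAt G M₂ M₁ (inj₁ a′)
  edge⇒¬mixed edge {a} {a′} o o′
    with b , ab∈M₁ ← oriented⇒matched M₁ M₂ o
    with b′ , a′b′∈M₂ ← oriented⇒matched M₂ M₁ o′
    = 1ℚ+1ℚ≢1ℚ (begin
      1ℚ + 1ℚ
        ≡⟨ cong₂ _+_ (sym (χ-matched J (trans (join-oriented M₁ M₂ stable₁ stable₂ o) ab∈M₁)))
                     (sym (χ-matched J (trans (join-reversed M₁ M₂ stable₁ stable₂ o′) a′b′∈M₂))) ⟩
      χ G J a b + χ G J a′ b′
        ≡⟨ segment-complementary {G = G} (χ G M₁) (χ G M₂) (χ G J) on-edge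
             (χ-matched M₁ ab∈M₁) (χ-unmatched M₂ (oriented⇒∉M′ M₁ M₂ o ab∈M₁))
             (χ-unmatched M₁ (oriented⇒∉M′ M₂ M₁ o′ a′b′∈M₂)) (χ-matched M₂ a′b′∈M₂) ⟩
      1ℚ ∎)
    where
    open ≡-Reasoning
    1ℚ+1ℚ≢1ℚ : 1ℚ + 1ℚ ≢ 1ℚ
    1ℚ+1ℚ≢1ℚ ()

    J = join M₁ M₂ stable₁ stable₂
    K = meet M₁ M₂ stable₁ stable₂

    on-edge : Segment G (χ G M₁) (χ G M₂) (χ G J)
    on-edge = edge-decomposition⇒segment edge
                (χ∈P J (join-stable M₁ M₂ stable₁ stable₂)) (χ∈P K (meet-stable M₁ M₂ stable₁ stable₂))
                (χ-complementary M₁ M₂ J K (join-meet-complementary M₁ M₂ stable₁ stable₂))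

module _ {m n : ℕ} {G : Instance m n} (M M′ : Matching G) (stable : Stable G M) (stable′ : Stable G M′) where
  open Instance G

  nontrivial⇒oriented⊎reversed : ∀ {v} → NonTrivial G M M′ v → OrientedAt G M M′ v ⊎ OrientedAt G M′ M v
  nontrivial⇒oriented⊎reversed {inj₁ a} (inj₂ b , ab∈M△M′) =
    Prefᴬ.connected G a (pA M a) (pA M′ a) (pA∈N M a) (pA∈N M′ a) (pA≢ ab∈M△M′)
    where
    pA≢ : SymDiff G M M′ a b → pA M a ≢ pA M′ a
    pA≢ (inj₁ (ab∈M , ab∉M′)) eq = ab∉M′ (trans (sym eq) ab∈M)
    pA≢ (inj₂ (ab∈M′ , ab∉M)) eq = ab∉M (trans eq ab∈M′)
  nontrivial⇒oriented⊎reversed {inj₂ b} (inj₁ a , ab∈M△M′) =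
    Prefᴮ.connected G b (pB M′ b) (pB M b) (pB∈N M′ b) (pB∈N M b) (pB≢ ab∈M△M′)
    where
    pB≢ : SymDiff G M M′ a b → pB M′ b ≢ pB M b
    pB≢ (inj₁ (ab∈M , ab∉M′)) eq = ab∉M′ (pB→pA M′ a b (trans eq (pA→pB M a b ab∈M)))
    pB≢ (inj₂ (ab∈M′ , ab∉M)) eq = ab∉M (pB→pA M a b (trans (sym eq) (pA→pB M′ a b ab∈M′)))

  unreversedᴬ⇒oriented : (∀ a → ¬ OrientedAt G M′ M (inj₁ a)) → Oriented G M M′
  unreversedᴬ⇒oriented unreversed v v-nontrivial with nontrivial⇒oriented⊎reversed v-nontrivial
  ... | inj₁ o  = (λ a v⇝a → oriented-reach M M′ stable stable′ v⇝a o) ,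
                   (λ b v⇝b → oriented-reach M M′ stable stable′ v⇝b o)
  ... | inj₂ o′ = ⊥-elim (unreversed-nontrivial v v-nontrivial o′)
    where
    unreversed-nontrivial : ∀ v → NonTrivial G M M′ v → ¬ OrientedAt G M′ M v
    unreversed-nontrivial (inj₁ a) _ = unreversed a
    unreversed-nontrivial (inj₂ b) (inj₁ a , ab∈M△M′) =
      unreversed a ∘ oriented-B⇒A M′ M stable′ stable (Sum.swap (Sum.map proj₁ proj₁ ab∈M△M′))

χ≢⇒partners-differ : ∀ {m n} {G : Instance m n} (M₁ M₂ : Matching G) →
                     ¬ (∀ a b → χ G M₁ a b ≡ χ G M₂ a b) → ∃ λ a → pA M₁ a ≢ pA M₂ a
χ≢⇒partners-differ {m} M₁ M₂ χ≢ =
  Fin.¬∀⟶∃¬ m (λ a → pA M₁ a ≡ pA M₂ a) (λ a → Maybe.≡-dec Fin._≟_ (pA M₁ a) (pA M₂ a))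
    (λ same → χ≢ (λ a → χ-cong M₁ M₂ (same a)))

lemma3 : (m n : ℕ) (G : Instance m n) (M₁ M₂ : Matching G) →
         Stable G M₁ → Stable G M₂ →
         IsEdge G (χ G M₁) (χ G M₂) →
         Oriented G M₁ M₂ ⊎ Oriented G M₂ M₁
lemma3 m n G M₁ M₂ stable₁ stable₂ edge
  with a₀ , M₁a₀≢M₂a₀ ← χ≢⇒partners-differ M₁ M₂ (proj₁ edge)
  with Prefᴬ.connected G a₀ (pA M₁ a₀) (pA M₂ a₀) (pA∈N M₁ a₀) (pA∈N M₂ a₀) M₁a₀≢M₂a₀
... | inj₁ o  = inj₁ (unreversedᴬ⇒oriented M₁ M₂ stable₁ stable₂ λ _ o′ →
                       edge⇒¬mixed M₁ M₂ stable₁ stable₂ edge o o′)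
... | inj₂ o′ = inj₂ (unreversedᴬ⇒oriented M₂ M₁ stable₂ stable₁ λ _ o →
                       edge⇒¬mixed M₁ M₂ stable₁ stable₂ edge o o′)
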